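{- Let $\mathcal{S}$ be an algebra (with finitely many operations) that admits an injective unary FA-presentation $(a^*,\phi)$, and let $\mathcal{T}$ be a finitely generated subalgebra of $\mathcal{S}$. Let $L \subseteq a^*$ be the set of words $w$ with $w\phi \in \mathcal{T}$. Then $L$ is a regular language, and a finite automaton recognizing $L$ can be constructed effectively (from automata for the FA-presentation) given a finite set of words in $a^*$ whose images under $\phi$ form a generating set for $\mathcal{T}$.
   Context: For words $w_1,\dots,w_n$ over a finite alphabet $A$, $\mathrm{conv}(w_1,\dots,w_n)$ is the word over $(A\cup\{\$\})^n$ ($\$$ a new symbol) whose $j$-th letter is the tuple of $j$-th letters of the $w_i$, where words shorter than the longest are padded at the end with $\$$. A relation $R\subseteq (A^*)^n$ is regular if $\{\mathrm{conv}(w_1,\dots,w_n):(w_1,\dots,w_n)\in R\}$ is a regular language. An algebra is regarded as a relational structure by replacing each $k$-ary operation $f$ by its graph, the $(k+1)$-ary relation $\{(x_1,\dots,x_k,(x_1,\dots,x_k)f)\}$. An FA-presentation of a relational structure $\mathcal{S}=(S,R_1,\dots,R_n)$ is a pair $(L,\phi)$ where $L$ is a regular language over a finite alphabet and $\phi:L\to S$ is surjective such that for each $R\in\{=,R_1,\dots,R_n\}$ of arity $r$, the relation $\Lambda(R,\phi)=\{(w_1,\dots,w_r)\in L^r: R(w_1\phi,\dots,w_r\phi)\}$ is regular. It is injective if $\phi$ is injective, and unary if $L$ is over a one-letter alphabet $\{a\}$. -}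

module Defs where

open import Data.Nat using (ℕ; zero; suc; _⊔_)
open import Data.Bool using (Bool; true; false)
open import Data.Unit using (⊤)
open import Data.Maybe using (Maybe; just; nothing)
open import Data.Fin using (Fin)
open import Data.List using (List; []; _∷_; foldl; length; upTo)
import Data.List as List
open import Data.Vec using (Vec; []; _∷_; init; last)
import Data.Vec as Vec
open import Data.Product using (Σ; ∃; _×_; _,_)
open import Data.List.Membership.Propositional using (_∈_)
open import Function using (Injective; Surjective)
open import Function.Bundles using (_⇔_)
open import Relation.Binary.PropositionalEquality using (_≡_)

-- Words over an alphabet A are lists.  The padding symbol $ is `nothing`.
Word : Set → Set
Word A = List A

letterAt : {A : Set} → Word A → ℕ → Maybe A
letterAt []       _       = nothing
letterAt (x ∷ w)  zero    = just x
letterAt (x ∷ w)  (suc j) = letterAt w j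

maxLength : {A : Set} {n : ℕ} → Vec (Word A) n → ℕ
maxLength []       = 0
maxLength (w ∷ ws) = length w ⊔ maxLength ws

conv : {A : Set} {n : ℕ} → Vec (Word A) n → Word (Vec (Maybe A) n)
conv ws = List.map (λ j → Vec.map (λ w → letterAt w j) ws) (upTo (maxLength ws))

record DFA (Σ : Set) : Set where
  field
    nStates : ℕ
    start   : Fin nStates
    δ       : Fin nStates → Σ → Fin nStates
    final   : Fin nStates → Bool

accepts : {Σ : Set} → DFA Σ → Word Σ → Bool
accepts M w = DFA.final M (foldl (DFA.δ M) (DFA.start M) w)

Recognizes : {Σ : Set} → DFA Σ → (Word Σ → Set) → Set
Recognizes {Σ} M L = (w : Word Σ) → (accepts M w ≡ true) ⇔ L w

RegularRelWitness : (A : Set) (n : ℕ) → (Vec (Word A) n → Set) → Set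
RegularRelWitness A n R =
  Σ (DFA (Vec (Maybe A) n)) λ M →
    Recognizes M (λ u → Σ (Vec (Word A) n) λ ws → (u ≡ conv ws) × R ws)

record Algebra : Set₁ where
  field
    Carrier : Set
    nOps    : ℕ
    arity   : Fin nOps → ℕ
    op      : (i : Fin nOps) → Vec Carrier (arity i) → Carrier

  Graph : (i : Fin nOps) → Vec Carrier (suc (arity i)) → Set
  Graph i v = op i (init v) ≡ last v

Λ : {A S : Set} {n : ℕ} → (Vec S n → Set) → (Word A → S) → Vec (Word A) n → Set
Λ R φ ws = R (Vec.map φ ws)

EqRel : {S : Set} → Vec S 2 → Set
EqRel (x ∷ y ∷ []) = x ≡ y

-- An injective unary FA-presentation (a*, φ) of the algebra 𝒮
-- (the one-letter alphabet {a} is ⊤; the language L is all of a*),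
-- carrying the automata for = and for each operation graph.
record InjUnaryFAPres (𝒮 : Algebra) : Set where
  open Algebra 𝒮
  field
    φ          : Word ⊤ → Carrier
    φ-inj      : Injective _≡_ _≡_ φ
    φ-surj     : Surjective _≡_ _≡_ φ
    eqAut      : RegularRelWitness ⊤ 2 (Λ EqRel φ)
    graphAut   : (i : Fin nOps) → RegularRelWitness ⊤ (suc (arity i)) (Λ (Graph i) φ)

data InSubalg (𝒮 : Algebra) (X : List (Algebra.Carrier 𝒮)) : Algebra.Carrier 𝒮 → Set where
  gen   : ∀ {x} → x ∈ X → InSubalg 𝒮 X x
  apply : (i : Fin (Algebra.nOps 𝒮)) (xs : Vec (Algebra.Carrier 𝒮) (Algebra.arity 𝒮 i)) →
          (∀ j → InSubalg 𝒮 X (Vec.lookup xs j)) → InSubalg 𝒮 X (Algebra.op 𝒮 i xs)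

module Submission where

-- Proof of Theorem 5.1.  Identify the word aⁿ with n.  The subalgebra 𝒯
-- generated by X = φ(gens) corresponds to the set of *derivable* n: the least
-- set closed under finitely many rules, each a regular relation on unary
-- tuples (the graph of an operation: "the arguments yield the value"; and for
-- each generator g, the singleton {|g|}).  We show that the derivable set of
-- any such rule system is regular:
--   (1) a deterministic automaton reading a 0/1-sequence β guesses rule
--       instances track by track and raises a sticky flag as soon as β has a
--       violation (premises true, conclusion false) below the current time;
--   (2) for an automaton with a sticky flag, the greedy sequence χ, which reads
--       0 whenever the flag can still be avoided for N more steps (N states),
--       avoids it forever (pumping) and is generated by a one-letter automaton;
--   (3) for the violation detector, χ is exactly the derivable set: it is
--       closed, so it contains all derivable numbers, and every 1 it reads is
--       forced by a violation, which yields a derivation.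

open import Defs
open import Data.Unit using (⊤; tt)
open import Data.Empty using (⊥; ⊥-elim)
open import Data.Bool using (Bool; true; false; _∧_; _∨_; not; if_then_else_)
open import Data.Bool.Properties using (∧-conicalˡ; ∧-conicalʳ; ∨-zeroʳ)
import Data.Bool.Properties as Bool
open import Data.Nat using (ℕ; zero; suc; _+_; _*_; _∸_; _<_; _≤_; _⊔_; _⊓_; _≤ᵇ_; _≡ᵇ_; z≤n; s≤s; z<s)
open import Data.Nat.Properties
open import Data.Nat.Induction using (<-rec)
open import Data.Fin using (Fin; zero; suc; toℕ; fromℕ; inject₁; _↑ˡ_; _↑ʳ_; splitAt; combine; remQuot)
import Data.Fin.Properties as Fin
open import Data.Maybe using (Maybe; just; nothing)
open import Data.Maybe.Properties using (just-injective)
open import Data.List using (List; []; _∷_; foldl; length; applyUpTo; upTo; replicate; map)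
import Data.List as List
import Data.List.Properties as List
open import Data.List.Membership.Propositional.Properties using (∈-map⁺; ∈-map⁻; ∈-lookup)
open import Data.List.Relation.Unary.Any using (index)
open import Data.List.Relation.Unary.Any.Properties using (lookup-index)
open import Data.Vec using (Vec; []; _∷_; lookup; tabulate; init; last; _∷ʳ_)
import Data.Vec as Vec
open import Data.Vec.Properties using (lookup∘tabulate; lookup-map; tabulate∘lookup; tabulate-cong)
open import Data.Product using (Σ; _×_; _,_; proj₁; proj₂)
open import Data.Sum using (_⊎_; inj₁; inj₂)
open import Function using (_∘_)
open import Function.Bundles using (_⇔_; Equivalence; mk⇔)
import Function.Properties.Equivalence as ⇔
open import Relation.Nullary using (Dec; yes; no; ¬_; does)
open import Relation.Nullary.Decidable using (dec-true; dec-false)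
open import Relation.Binary.PropositionalEquality
open import Relation.Binary.Definitions using (tri<; tri≈; tri>)

record Finite (A : Set) : Set where
  field
    size          : ℕ
    encode        : A → Fin size
    decode        : Fin size → A
    decode-encode : ∀ a → decode (encode a) ≡ a

open Finite

retract : {A B : Set} → Finite A → (f : A → B) (g : B → A) → (∀ b → f (g b) ≡ b) → Finite B
retract fa f g fg = record
  { size = size fa ; encode = encode fa ∘ g ; decode = f ∘ decode fa
  ; decode-encode = λ b → trans (cong f (decode-encode fa (g b))) (fg b) }

finite-Fin : (n : ℕ) → Finite (Fin n)
finite-Fin n = record { size = n ; encode = λ x → x ; decode = λ x → x ; decode-encode = λ _ → refl }

finite-Bool : Finite Bool
finite-Bool = retract (finite-Fin 2) (λ { zero → false ; (suc _) → true })
  (λ { false → zero ; true → suc zero }) (λ { false → refl ; true → refl })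

finite-× : {A B : Set} → Finite A → Finite B → Finite (A × B)
finite-× {A} {B} fa fb = retract (finite-Fin (size fa * size fb)) dec enc dec-enc
  where
  decPair : Fin (size fa) × Fin (size fb) → A × B
  decPair (i , j) = decode fa i , decode fb j
  dec : Fin (size fa * size fb) → A × B
  dec p = decPair (remQuot (size fb) p)
  enc : A × B → Fin (size fa * size fb)
  enc (a , b) = combine (encode fa a) (encode fb b)
  dec-enc : ∀ x → dec (enc x) ≡ x
  dec-enc (a , b) = trans (cong decPair (Fin.remQuot-combine (encode fa a) (encode fb b)))
                          (cong₂ _,_ (decode-encode fa a) (decode-encode fb b))

finite-⊎ : {A B : Set} → Finite A → Finite B → Finite (A ⊎ B)
finite-⊎ {A} {B} fa fb = retract (finite-Fin (size fa + size fb)) dec enc dec-enc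
  where
  decSum : Fin (size fa) ⊎ Fin (size fb) → A ⊎ B
  decSum (inj₁ i) = inj₁ (decode fa i)
  decSum (inj₂ j) = inj₂ (decode fb j)
  dec : Fin (size fa + size fb) → A ⊎ B
  dec p = decSum (splitAt (size fa) p)
  enc : A ⊎ B → Fin (size fa + size fb)
  enc (inj₁ a) = encode fa a ↑ˡ size fb
  enc (inj₂ b) = size fa ↑ʳ encode fb b
  dec-enc : ∀ x → dec (enc x) ≡ x
  dec-enc (inj₁ a) = trans (cong decSum (Fin.splitAt-↑ˡ (size fa) (encode fa a) (size fb)))
                           (cong inj₁ (decode-encode fa a))
  dec-enc (inj₂ b) = trans (cong decSum (Fin.splitAt-↑ʳ (size fa) (size fb) (encode fb b)))
                           (cong inj₂ (decode-encode fb b))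

finite-Vec : {A : Set} → Finite A → (m : ℕ) → Finite (Vec A m)
finite-Vec fa zero    = retract (finite-Fin 1) (λ _ → []) (λ _ → zero) (λ { [] → refl })
finite-Vec fa (suc m) = retract (finite-× fa (finite-Vec fa m)) (λ (x , xs) → x ∷ xs)
  (λ { (x ∷ xs) → x , xs }) (λ { (x ∷ xs) → refl })

finite-ΣFin : (n : ℕ) (B : Fin n → Set) → (∀ i → Finite (B i)) → Finite (Σ (Fin n) B)
finite-ΣFin zero    B fB = record
  { size = 0 ; encode = λ { (() , _) } ; decode = λ () ; decode-encode = λ { (() , _) } }
finite-ΣFin (suc n) B fB =
  retract (finite-⊎ (fB zero) (finite-ΣFin n (B ∘ suc) (fB ∘ suc)))
    (λ { (inj₁ b) → zero , b ; (inj₂ (i , b)) → suc i , b })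
    (λ { (zero , b) → inj₁ b ; (suc i , b) → inj₂ (i , b) })
    (λ { (zero , b) → refl ; (suc i , b) → refl })

finite-Σ : {A : Set} {B : A → Set} → (fa : Finite A) → (∀ a → Finite (B a)) → Finite (Σ A B)
finite-Σ {A} {B} fa fB =
  retract (finite-ΣFin (size fa) (B ∘ decode fa) (fB ∘ decode fa))
    (λ (i , b) → decode fa i , b) (λ (a , b) → encode fa a , subst B (sym (decode-encode fa a)) b)
    (λ (a , b) → reindex (decode-encode fa a) b)
  where
  reindex : ∀ {a a′} (p : a′ ≡ a) (b : B a) → (a′ , subst B (sym p) b) ≡ (a , b)
  reindex refl b = refl

does-true⇒ : {P : Set} (p? : Dec P) → does p? ≡ true → P
does-true⇒ (yes p) _ = p

does-false⇒ : {P : Set} (p? : Dec P) → does p? ≡ false → ¬ P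
does-false⇒ (no ¬p) _ = ¬p

true≢false : true ≢ false
true≢false ()

∨-true : ∀ {a b} → a ∨ b ≡ true → a ≡ true ⊎ b ≡ true
∨-true {true}  _ = inj₁ refl
∨-true {false} h = inj₂ h

∨-introˡ : ∀ {a} b → a ≡ true → a ∨ b ≡ true
∨-introˡ b refl = refl

∨-introʳ : ∀ a {b} → b ≡ true → a ∨ b ≡ true
∨-introʳ a refl = ∨-zeroʳ a

∧-intro : ∀ {a b} → a ≡ true → b ≡ true → a ∧ b ≡ true
∧-intro refl refl = refl

_⇒ᵇ_ : Bool → Bool → Bool
a ⇒ᵇ b = not a ∨ b

_≡ᶠ_ : {n : ℕ} → Fin n → Fin n → Bool
x ≡ᶠ y = does (x Fin.≟ y)

_≡ᴮ_ : Bool → Bool → Bool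
a ≡ᴮ b = does (a Bool.≟ b)

≤ᵇ-true⇒ : ∀ m n → (m ≤ᵇ n) ≡ true → m ≤ n
≤ᵇ-true⇒ m n = does-true⇒ (m ≤? n)

≤ᵇ-false⇒ : ∀ m n → (m ≤ᵇ n) ≡ false → n < m
≤ᵇ-false⇒ m n h = ≰⇒> (does-false⇒ (m ≤? n) h)

≤⇒≤ᵇ-true : ∀ {m n} → m ≤ n → (m ≤ᵇ n) ≡ true
≤⇒≤ᵇ-true {m} {n} = dec-true (m ≤? n)

>⇒≤ᵇ-false : ∀ {m n} → n < m → (m ≤ᵇ n) ≡ false
>⇒≤ᵇ-false {m} {n} n<m = dec-false (m ≤? n) (<⇒≱ n<m)

≤ᵇ-suc-true : ∀ n m → (suc n ≤ᵇ m) ≡ true → (n ≤ᵇ m) ≡ true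
≤ᵇ-suc-true n m h = ≤⇒≤ᵇ-true (≤-trans (n≤1+n n) (≤ᵇ-true⇒ (suc n) m h))

≤ᵇ-suc-false : ∀ n m → (n ≤ᵇ m) ≡ false → (suc n ≤ᵇ m) ≡ false
≤ᵇ-suc-false n m h = >⇒≤ᵇ-false (≤-trans (≤ᵇ-false⇒ n m h) (n≤1+n n))

≤ᵇ-exact : ∀ n m → (n ≤ᵇ m) ≡ true → (suc n ≤ᵇ m) ≡ false → m ≡ n
≤ᵇ-exact n m h₁ h₂ = ≤-antisym (≤-pred (≤ᵇ-false⇒ (suc n) m h₂)) (≤ᵇ-true⇒ n m h₁)

-- They are opaque so that type checking does not unfold them inside the
-- detector's transition function; only the lemmas below are used.
opaque
  anyFin : (n : ℕ) → (Fin n → Bool) → Bool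
  anyFin zero    f = false
  anyFin (suc n) f = f zero ∨ anyFin n (f ∘ suc)

  anyFin-witness : ∀ n f → anyFin n f ≡ true → Σ (Fin n) λ i → f i ≡ true
  anyFin-witness (suc n) f h with ∨-true {f zero} h
  ... | inj₁ p = zero , p
  ... | inj₂ p = let (i , q) = anyFin-witness n (f ∘ suc) p in suc i , q

  anyFin-intro : ∀ n f i → f i ≡ true → anyFin n f ≡ true
  anyFin-intro (suc n) f zero    h = ∨-introˡ _ h
  anyFin-intro (suc n) f (suc i) h = ∨-introʳ (f zero) (anyFin-intro n (f ∘ suc) i h)

  allFin : (n : ℕ) → (Fin n → Bool) → Bool
  allFin zero    f = true
  allFin (suc n) f = f zero ∧ allFin n (f ∘ suc)

  allFin-elim : ∀ n f → allFin n f ≡ true → ∀ i → f i ≡ true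
  allFin-elim (suc n) f h zero    = ∧-conicalˡ _ _ h
  allFin-elim (suc n) f h (suc i) = allFin-elim n (f ∘ suc) (∧-conicalʳ (f zero) _ h) i

  allFin-intro : ∀ n f → (∀ i → f i ≡ true) → allFin n f ≡ true
  allFin-intro zero    f h = refl
  allFin-intro (suc n) f h = ∧-intro (h zero) (allFin-intro n (f ∘ suc) (h ∘ suc))

  anyVec : (m : ℕ) → (Vec Bool m → Bool) → Bool
  anyVec zero    f = f []
  anyVec (suc m) f = anyVec m (f ∘ (false ∷_)) ∨ anyVec m (f ∘ (true ∷_))

  anyVec-witness : ∀ m f → anyVec m f ≡ true → Σ (Vec Bool m) λ v → f v ≡ true
  anyVec-witness zero    f h = [] , h
  anyVec-witness (suc m) f h with ∨-true {anyVec m (f ∘ (false ∷_))} h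
  ... | inj₁ p = let (v , q) = anyVec-witness m (f ∘ (false ∷_)) p in false ∷ v , q
  ... | inj₂ p = let (v , q) = anyVec-witness m (f ∘ (true ∷_)) p in true ∷ v , q

  anyVec-intro : ∀ m f v → f v ≡ true → anyVec m f ≡ true
  anyVec-intro zero    f []          h = h
  anyVec-intro (suc m) f (false ∷ v) h = ∨-introˡ _ (anyVec-intro m (f ∘ (false ∷_)) v h)
  anyVec-intro (suc m) f (true ∷ v)  h =
    ∨-introʳ (anyVec m (f ∘ (false ∷_))) (anyVec-intro m (f ∘ (true ∷_)) v h)

anyFin-false : ∀ n f → anyFin n f ≡ false → ∀ i → f i ≡ false
anyFin-false n f h i with f i in e
... | false = refl
... | true  = ⊥-elim (true≢false (trans (sym (anyFin-intro n f i e)) h))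

lookup-ext : {A : Set} {k : ℕ} (xs ys : Vec A k) → (∀ i → lookup xs i ≡ lookup ys i) → xs ≡ ys
lookup-ext xs ys h = trans (sym (tabulate∘lookup xs)) (trans (tabulate-cong h) (tabulate∘lookup ys))

lookup-init : {A : Set} {k : ℕ} (xs : Vec A (suc k)) (j : Fin k) → lookup (init xs) j ≡ lookup xs (inject₁ j)
lookup-init (x ∷ y ∷ xs) zero    = refl
lookup-init (x ∷ y ∷ xs) (suc j) = lookup-init (y ∷ xs) j

lookup-last : {A : Set} {k : ℕ} (xs : Vec A (suc k)) → last xs ≡ lookup xs (fromℕ k)
lookup-last (x ∷ [])     = refl
lookup-last (x ∷ y ∷ xs) = lookup-last (y ∷ xs)

lookup-∷ʳ-inject₁ : {A : Set} {k : ℕ} (xs : Vec A k) (x : A) (j : Fin k) → lookup (xs ∷ʳ x) (inject₁ j) ≡ lookup xs j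
lookup-∷ʳ-inject₁ (y ∷ xs) x zero    = refl
lookup-∷ʳ-inject₁ (y ∷ xs) x (suc j) = lookup-∷ʳ-inject₁ xs x j

lookup-∷ʳ-fromℕ : {A : Set} {k : ℕ} (xs : Vec A k) (x : A) → lookup (xs ∷ʳ x) (fromℕ k) ≡ x
lookup-∷ʳ-fromℕ []       x = refl
lookup-∷ʳ-fromℕ (y ∷ xs) x = lookup-∷ʳ-fromℕ xs x

maxᵛ : {k : ℕ} → Vec ℕ k → ℕ
maxᵛ []       = 0
maxᵛ (m ∷ ns) = m ⊔ maxᵛ ns

lookup≤maxᵛ : ∀ {k} (ns : Vec ℕ k) i → lookup ns i ≤ maxᵛ ns
lookup≤maxᵛ (m ∷ ns) zero    = m≤m⊔n m (maxᵛ ns)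
lookup≤maxᵛ (m ∷ ns) (suc i) = ≤-trans (lookup≤maxᵛ ns i) (m≤n⊔m m (maxᵛ ns))

maxᵛ-least : ∀ {k} (ns : Vec ℕ k) n → (∀ i → lookup ns i ≤ n) → maxᵛ ns ≤ n
maxᵛ-least []       n h = z≤n
maxᵛ-least (m ∷ ns) n h = ⊔-lub (h zero) (maxᵛ-least ns n (h ∘ suc))

maxᵛ-attained : ∀ {k} (ns : Vec ℕ k) n → (∀ i → lookup ns i ≤ n) → (i : Fin k) → lookup ns i ≡ n → maxᵛ ns ≡ n
maxᵛ-attained ns n h i e = ≤-antisym (maxᵛ-least ns n h) (subst (_≤ maxᵛ ns) e (lookup≤maxᵛ ns i))

unary : ℕ → Word ⊤
unary n = replicate n tt

unary-length : (w : Word ⊤) → unary (length w) ≡ w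
unary-length []       = refl
unary-length (tt ∷ w) = cong (tt ∷_) (unary-length w)

unary-lengths : ∀ {k} (ws : Vec (Word ⊤) k) → Vec.map unary (Vec.map length ws) ≡ ws
unary-lengths []       = refl
unary-lengths (w ∷ ws) = cong₂ _∷_ (unary-length w) (unary-lengths ws)

bit : Bool → Maybe ⊤
bit true  = just tt
bit false = nothing

track : ℕ → ℕ → Maybe ⊤
track m j = bit (suc j ≤ᵇ m)

letterAt-unary : ∀ m j → letterAt (unary m) j ≡ track m j
letterAt-unary zero    j       = refl
letterAt-unary (suc m) zero    = refl
letterAt-unary (suc m) (suc j) = letterAt-unary m j

track-< : ∀ m j → j < m → track m j ≡ just tt
track-< m j j<m = cong bit (≤⇒≤ᵇ-true j<m)

track-≥ : ∀ m j → m ≤ j → track m j ≡ nothing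
track-≥ m j m≤j = cong bit (>⇒≤ᵇ-false (s≤s m≤j))

track-injective : ∀ m m′ → (∀ j → track m j ≡ track m′ j) → m ≡ m′
track-injective zero    zero     h = refl
track-injective zero    (suc m′) h with h 0
... | ()
track-injective (suc m) zero     h with h 0
... | ()
track-injective (suc m) (suc m′) h = cong suc (track-injective m m′ (h ∘ suc))

column : {k : ℕ} → Vec ℕ k → ℕ → Vec (Maybe ⊤) k
column ns j = Vec.map (λ m → track m j) ns

maxLength-unary : ∀ {k} (ns : Vec ℕ k) → maxLength (Vec.map unary ns) ≡ maxᵛ ns
maxLength-unary []       = refl
maxLength-unary (m ∷ ns) = cong₂ _⊔_ (List.length-replicate m) (maxLength-unary ns)

letters-unary : ∀ {k} (ns : Vec ℕ k) j → Vec.map (λ w → letterAt w j) (Vec.map unary ns) ≡ column ns j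
letters-unary []       j = refl
letters-unary (m ∷ ns) j = cong₂ _∷_ (letterAt-unary m j) (letters-unary ns j)

conv-unary : ∀ {k} (ns : Vec ℕ k) → conv (Vec.map unary ns) ≡ applyUpTo (column ns) (maxᵛ ns)
conv-unary ns = trans (List.map-cong (letters-unary ns) (upTo (maxLength (Vec.map unary ns))))
  (trans (List.map-upTo (column ns) _) (cong (applyUpTo (column ns)) (maxLength-unary ns)))

letterAt-applyUpTo : {B : Set} (f : ℕ → B) (M j : ℕ) → j < M → letterAt (applyUpTo f M) j ≡ just (f j)
letterAt-applyUpTo f (suc M) zero    _         = refl
letterAt-applyUpTo f (suc M) (suc j) (s≤s j<M) = letterAt-applyUpTo (f ∘ suc) M j j<M

conv-unary-injective : ∀ {k} (ns ns′ : Vec ℕ k) → conv (Vec.map unary ns) ≡ conv (Vec.map unary ns′) → ns ≡ ns′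
conv-unary-injective ns ns′ e =
  lookup-ext ns ns′ (λ c → track-injective _ _ (λ j → tracks-agree c j))
  where
  e′ : applyUpTo (column ns) (maxᵛ ns) ≡ applyUpTo (column ns′) (maxᵛ ns′)
  e′ = trans (sym (conv-unary ns)) (trans e (conv-unary ns′))
  max≡ : maxᵛ ns ≡ maxᵛ ns′
  max≡ = trans (sym (List.length-applyUpTo (column ns) _))
               (trans (cong length e′) (List.length-applyUpTo (column ns′) _))
  track-at : ∀ {k} (ms : Vec ℕ k) c j → lookup (column ms j) c ≡ track (lookup ms c) j
  track-at ms c j = lookup-map c (λ m → track m j) ms
  tracks-agree : ∀ c j → track (lookup ns c) j ≡ track (lookup ns′ c) j
  tracks-agree c j with j <? maxᵛ ns
  ... | yes j<M = trans (sym (track-at ns c j)) (trans (cong (λ col → lookup col c) columns≡) (track-at ns′ c j))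
    where
    columns≡ : column ns j ≡ column ns′ j
    columns≡ = just-injective (trans (sym (letterAt-applyUpTo (column ns) _ j j<M))
      (trans (cong (λ u → letterAt u j) e′) (letterAt-applyUpTo (column ns′) _ j (subst (j <_) max≡ j<M))))
  ... | no j≮M = trans (track-≥ _ j (≤-trans (lookup≤maxᵛ ns c) M≤j))
                       (sym (track-≥ _ j (≤-trans (lookup≤maxᵛ ns′ c) (subst (_≤ j) max≡ M≤j))))
    where
    M≤j = ≮⇒≥ j≮M

module _ {S : Set} (M : DFA S) where
  open DFA M

  runFrom : Fin nStates → (ℕ → S) → ℕ → Fin nStates
  runFrom q f zero    = q
  runFrom q f (suc n) = runFrom (δ q (f 0)) (f ∘ suc) n

  runFrom-snoc : ∀ n q f → runFrom q f (suc n) ≡ δ (runFrom q f n) (f n)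
  runFrom-snoc zero    q f = refl
  runFrom-snoc (suc n) q f = runFrom-snoc n (δ q (f 0)) (f ∘ suc)

  runFrom-split : ∀ a b q f → runFrom q f (a + b) ≡ runFrom (runFrom q f a) (λ j → f (a + j)) b
  runFrom-split zero    b q f = refl
  runFrom-split (suc a) b q f = runFrom-split a b (δ q (f 0)) (f ∘ suc)

  runFrom-cong : ∀ n q f g → (∀ j → j < n → f j ≡ g j) → runFrom q f n ≡ runFrom q g n
  runFrom-cong zero    q f g h = refl
  runFrom-cong (suc n) q f g h rewrite h 0 (s≤s z≤n) =
    runFrom-cong n (δ q (g 0)) (f ∘ suc) (g ∘ suc) (λ j j<n → h (suc j) (s≤s j<n))

  foldl-applyUpTo : ∀ n q f → foldl δ q (applyUpTo f n) ≡ runFrom q f n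
  foldl-applyUpTo zero    q f = refl
  foldl-applyUpTo (suc n) q f = foldl-applyUpTo n (δ q (f 0)) (f ∘ suc)

accepts-unary : ∀ {k} (M : DFA (Vec (Maybe ⊤) k)) (ns : Vec ℕ k) →
  accepts M (conv (Vec.map unary ns)) ≡ DFA.final M (runFrom M (DFA.start M) (column ns) (maxᵛ ns))
accepts-unary M ns = cong (DFA.final M)
  (trans (cong (foldl (DFA.δ M) (DFA.start M)) (conv-unary ns)) (foldl-applyUpTo M (maxᵛ ns) _ (column ns)))

-- M reads 0/1-sequences and is a safety automaton: once it leaves its final
-- states it never returns (a run is "rejected" from then on).  The greedy
-- sequence χ reads false whenever rejection can still be avoided for N more
-- steps (N the number of states); by pumping, it is then avoided forever.
module Greedy (M : DFA Bool) (sticky : ∀ q b → DFA.final M q ≡ false → DFA.final M (DFA.δ M q b) ≡ false) where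
  open DFA M renaming (nStates to N)

  stays-rejected : ∀ k q v → final q ≡ false → final (runFrom M q v k) ≡ false
  stays-rejected zero    q v r = r
  stays-rejected (suc k) q v r = stays-rejected k (δ q (v 0)) (v ∘ suc) (sticky q (v 0) r)

  unrejected-prefix : ∀ k m q v → k ≤ m → final (runFrom M q v m) ≡ true → final (runFrom M q v k) ≡ true
  unrejected-prefix k m q v k≤m h with final (runFrom M q v k) in e
  ... | true  = refl
  ... | false = ⊥-elim (true≢false (begin
      true                                                         ≡⟨ sym h ⟩
      final (runFrom M q v m)                                       ≡⟨ cong (λ x → final (runFrom M q v x)) (sym (m+[n∸m]≡n k≤m)) ⟩
      final (runFrom M q v (k + (m ∸ k)))                           ≡⟨ cong final (runFrom-split M k (m ∸ k) q v) ⟩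
      final (runFrom M (runFrom M q v k) (λ j → v (k + j)) (m ∸ k)) ≡⟨ stays-rejected (m ∸ k) _ (λ j → v (k + j)) e ⟩
      false                                                         ∎))
    where open ≡-Reasoning

  safe : ℕ → Fin N → Bool
  safe zero    q = final q
  safe (suc k) q = safe k (δ q false) ∨ safe k (δ q true)

  prepend : Bool → (ℕ → Bool) → ℕ → Bool
  prepend b v zero    = b
  prepend b v (suc j) = v j

  safe-witness : ∀ k q → safe k q ≡ true → Σ (ℕ → Bool) λ v → final (runFrom M q v k) ≡ true
  safe-witness zero    q h = (λ _ → false) , h
  safe-witness (suc k) q h with safe k (δ q false) in e
  ... | true  = let (v , p) = safe-witness k (δ q false) e in prepend false v , p
  ... | false = let (v , p) = safe-witness k (δ q true) h in prepend true v , p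

  safe-intro : ∀ k q v → final (runFrom M q v k) ≡ true → safe k q ≡ true
  safe-intro zero    q v h = h
  safe-intro (suc k) q v h with v 0
  ... | false = ∨-introˡ _ (safe-intro k (δ q false) (v ∘ suc) h)
  ... | true  = ∨-introʳ (safe k (δ q false)) (safe-intro k (δ q true) (v ∘ suc) h)

  unsafe-rejects : ∀ k q → safe k q ≡ false → ∀ v → final (runFrom M q v k) ≡ false
  unsafe-rejects k q h v with final (runFrom M q v k) in e
  ... | false = refl
  ... | true  = ⊥-elim (true≢false (trans (sym (safe-intro k q v e)) h))

  safe⇒unrejected : ∀ k q → safe k q ≡ true → final q ≡ true
  safe⇒unrejected k q h = let (v , p) = safe-witness k q h in unrejected-prefix 0 k q v z≤n p

  -- Pumping: a rejection-free run of N steps revisits a state, so its loop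
  -- can be repeated to make it one step longer.
  module _ (v : ℕ → Bool) (a b : ℕ) where
    loopAt : ℕ → Bool
    loopAt m with m <? b
    ... | yes _ = v m
    ... | no  _ = v (m ∸ b + a)

    loopAt-< : ∀ m → m < b → loopAt m ≡ v m
    loopAt-< m m<b with m <? b
    ... | yes _  = refl
    ... | no m≮b = ⊥-elim (m≮b m<b)

    loopAt-≥ : ∀ t → loopAt (b + t) ≡ v (a + t)
    loopAt-≥ t with (b + t) <? b
    ... | yes b+t<b = ⊥-elim (<-irrefl refl (≤-trans b+t<b (m≤m+n b t)))
    ... | no  _     = cong v (trans (cong (_+ a) (m+n∸m≡n b t)) (+-comm t a))

  safe-extend : ∀ q → safe N q ≡ true → safe (suc N) q ≡ true
  safe-extend q h with safe-witness N q h
  ... | v , ok with Fin.pigeonhole (n<1+n N) (λ i → runFrom M q v (toℕ i))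
  ... | i , j , i<j , same = safe-intro (suc N) q w
          (unrejected-prefix (suc N) (b + (N ∸ a)) q w longer (trans (cong final pumped) ok))
    where
    a = toℕ i
    b = toℕ j
    w = loopAt v a b
    a≤N : a ≤ N
    a≤N = ≤-pred (Fin.toℕ<n i)
    pumped : runFrom M q w (b + (N ∸ a)) ≡ runFrom M q v N
    pumped = begin
        runFrom M q w (b + (N ∸ a))
      ≡⟨ runFrom-split M b (N ∸ a) q w ⟩
        runFrom M (runFrom M q w b) (λ t → w (b + t)) (N ∸ a)
      ≡⟨ cong (λ x → runFrom M x (λ t → w (b + t)) (N ∸ a))
              (trans (runFrom-cong M b q w v (loopAt-< v a b)) (sym same)) ⟩
        runFrom M (runFrom M q v a) (λ t → w (b + t)) (N ∸ a)
      ≡⟨ runFrom-cong M (N ∸ a) _ _ _ (λ t _ → loopAt-≥ v a b t) ⟩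
        runFrom M (runFrom M q v a) (λ t → v (a + t)) (N ∸ a)
      ≡⟨ sym (runFrom-split M a (N ∸ a) q v) ⟩
        runFrom M q v (a + (N ∸ a))
      ≡⟨ cong (runFrom M q v) (m+[n∸m]≡n a≤N) ⟩
        runFrom M q v N
      ∎
      where open ≡-Reasoning
    longer : suc N ≤ b + (N ∸ a)
    longer = ≤-trans (≤-reflexive (sym (m+[n∸m]≡n {suc a} {suc N} (s≤s a≤N)))) (+-monoˡ-≤ (N ∸ a) i<j)

  choice : Fin N → Bool
  choice q = not (safe N (δ q false))

  greedyStep : Fin N → Fin N
  greedyStep q = δ q (choice q)

  greedyState : ℕ → Fin N
  greedyState zero    = start
  greedyState (suc n) = greedyStep (greedyState n)

  χ : ℕ → Bool
  χ n = choice (greedyState n)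

  runFrom-χ : ∀ n → runFrom M start χ n ≡ greedyState n
  runFrom-χ zero    = refl
  runFrom-χ (suc n) = trans (runFrom-snoc M n start χ) (cong (λ q → δ q (χ n)) (runFrom-χ n))

  greedyStep-safe : ∀ q → safe N q ≡ true → safe N (greedyStep q) ≡ true
  greedyStep-safe q h with safe N (δ q false) in e
  ... | true  = e
  ... | false = subst (λ x → x ∨ safe N (δ q true) ≡ true) e (safe-extend q h)

  χ-unrejected : safe N start ≡ true → ∀ n → final (runFrom M start χ n) ≡ true
  χ-unrejected h n = trans (cong final (runFrom-χ n)) (safe⇒unrejected N (greedyState n) (safe-invariant n))
    where
    safe-invariant : ∀ n → safe N (greedyState n) ≡ true
    safe-invariant zero    = h
    safe-invariant (suc n) = greedyStep-safe (greedyState n) (safe-invariant n)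

  χ-forced : ∀ n → χ n ≡ true → (w : ℕ → Bool) → (∀ j → j < n → w j ≡ χ j) → w n ≡ false →
             final (runFrom M start w (suc n + N)) ≡ false
  χ-forced n χn w agree wn = trans (cong final reach)
    (unsafe-rejects N (δ (greedyState n) false) (Bool.not-injective χn) (λ j → w (suc n + j)))
    where
    reach : runFrom M start w (suc n + N) ≡ runFrom M (δ (greedyState n) false) (λ j → w (suc n + j)) N
    reach = begin
        runFrom M start w (suc n + N)
      ≡⟨ runFrom-split M (suc n) N start w ⟩
        runFrom M (runFrom M start w (suc n)) (λ j → w (suc n + j)) N
      ≡⟨ cong (λ q → runFrom M q (λ j → w (suc n + j)) N) (trans (runFrom-snoc M n start w)
           (cong₂ δ (trans (runFrom-cong M n start w χ agree) (runFrom-χ n)) wn)) ⟩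
        runFrom M (δ (greedyState n) false) (λ j → w (suc n + j)) N
      ∎
      where open ≡-Reasoning

-- The number of false entries among v 0, …, v (k-1); it bounds the number
-- of rounds of the search for a derivation in χ⇒derivable-step.
falses : ℕ → (ℕ → Bool) → ℕ
falses zero    v = 0
falses (suc k) v = (if v k then 0 else 1) + falses k v

falses-cong : ∀ k v v′ → (∀ i → i < k → v i ≡ v′ i) → falses k v ≡ falses k v′
falses-cong zero    v v′ h = refl
falses-cong (suc k) v v′ h =
  cong₂ (λ x y → (if x then 0 else 1) + y) (h k ≤-refl) (falses-cong k v v′ (λ i i<k → h i (m≤n⇒m≤1+n i<k)))

falses-allFalse : ∀ k → falses k (λ _ → false) ≡ k
falses-allFalse zero    = refl
falses-allFalse (suc k) = cong suc (falses-allFalse k)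

setTrue : (ℕ → Bool) → ℕ → ℕ → Bool
setTrue v j m = v m ∨ (m ≡ᵇ j)

setTrue-other : ∀ v j m → m ≢ j → setTrue v j m ≡ v m
setTrue-other v j m m≢j = trans (cong (v m ∨_) (dec-false (m ≟ j) m≢j)) (Bool.∨-identityʳ (v m))

≡ᵇ-refl : ∀ k → (k ≡ᵇ k) ≡ true
≡ᵇ-refl k = dec-true (k ≟ k) refl

falses-setTrue : ∀ k v j → j < k → v j ≡ false → suc (falses k (setTrue v j)) ≤ falses k v
falses-setTrue (suc k) v j j<1+k vj with <-cmp j k
... | tri< j<k _ _ rewrite setTrue-other v j k (>⇒≢ j<k) =
  ≤-trans (≤-reflexive (sym (+-suc _ _))) (+-monoʳ-≤ (if v k then 0 else 1) (falses-setTrue k v j j<k vj))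
... | tri≈ _ refl _ rewrite vj | ≡ᵇ-refl j =
  s≤s (≤-reflexive (falses-cong j (setTrue v j) v (λ i i<j → setTrue-other v j i (<⇒≢ i<j))))
... | tri> _ _ k<j = ⊥-elim (<⇒≱ k<j (≤-pred j<1+k))

-- splice u n v: u below n, false at n, and v read from position n+1 on.
-- Splicing χ at n tests whether its bit at n could be switched off.
splice : (ℕ → Bool) → ℕ → (ℕ → Bool) → ℕ → Bool
splice u n v m with <-cmp m n
... | tri< _ _ _ = u m
... | tri≈ _ _ _ = false
... | tri> _ _ _ = v (m ∸ suc n)

splice-< : ∀ u n v m → m < n → splice u n v m ≡ u m
splice-< u n v m m<n with <-cmp m n
... | tri< _ _ _    = refl
... | tri≈ m≮n _ _ = ⊥-elim (m≮n m<n)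
... | tri> m≮n _ _ = ⊥-elim (m≮n m<n)

splice-≡ : ∀ u n v → splice u n v n ≡ false
splice-≡ u n v with <-cmp n n
... | tri< _ n≢n _ = ⊥-elim (n≢n refl)
... | tri≈ _ _ _   = refl
... | tri> _ n≢n _ = ⊥-elim (n≢n refl)

splice-true : ∀ u n v m → splice u n v m ≡ true → (m < n × u m ≡ true) ⊎ (n < m × v (m ∸ suc n) ≡ true)
splice-true u n v m h with <-cmp m n
... | tri< m<n _ _ = inj₁ (m<n , h)
... | tri> _ _ n<m = inj₂ (n<m , h)

splice-false : ∀ u n v m → splice u n v m ≡ false →
               (m < n × u m ≡ false) ⊎ (m ≡ n) ⊎ (n < m × v (m ∸ suc n) ≡ false)
splice-false u n v m h with <-cmp m n
... | tri< m<n _ _ = inj₁ (m<n , h)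
... | tri≈ _ m≡n _ = inj₂ (inj₁ m≡n)
... | tri> _ _ n<m = inj₂ (inj₂ (n<m , h))

-- A rule instance is a tuple of length k+1: the first k positions are the
-- premises, the last position (fromℕ k) is the conclusion.
isPremise : {k : ℕ} → Fin (suc k) → Bool
isPremise {zero}  zero    = false
isPremise {suc k} zero    = true
isPremise {suc k} (suc c) = isPremise c

isPremise-fromℕ : ∀ k → isPremise (fromℕ k) ≡ false
isPremise-fromℕ zero    = refl
isPremise-fromℕ (suc k) = isPremise-fromℕ k

isPremise-inject₁ : ∀ {k} (j : Fin k) → isPremise (inject₁ j) ≡ true
isPremise-inject₁ {suc k} zero    = refl
isPremise-inject₁ {suc k} (suc j) = isPremise-inject₁ j

premise-or-conclusion : ∀ {k} (c : Fin (suc k)) → isPremise c ≡ true ⊎ c ≡ fromℕ k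
premise-or-conclusion {zero}  zero    = inj₂ refl
premise-or-conclusion {suc k} zero    = inj₁ refl
premise-or-conclusion {suc k} (suc c) with premise-or-conclusion c
... | inj₁ p = inj₁ p
... | inj₂ p = inj₂ (cong suc p)

premise-inject₁ : ∀ {k} (c : Fin (suc k)) → isPremise c ≡ true → Σ (Fin k) λ j → c ≡ inject₁ j
premise-inject₁ {suc k} zero    _ = zero , refl
premise-inject₁ {suc k} (suc c) h = let (j , e) = premise-inject₁ c h in suc j , cong suc e

roles-of : ∀ {k} (ns : Vec ℕ (suc k)) (β : ℕ → Bool) → (∀ c → isPremise c ≡ true → β (lookup ns c) ≡ true) →
           β (lookup ns (fromℕ k)) ≡ false → ∀ c → β (lookup ns c) ≡ isPremise c
roles-of {k} ns β premises conclusion c with premise-or-conclusion c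
... | inj₁ p    = trans (premises c p) (sym p)
... | inj₂ refl = trans conclusion (sym (isPremise-fromℕ k))

-- Finitely many rules r, each given by an automaton over (k_r+1)-track unary
-- convolutions; an accepted tuple (n₁, …, n_k, m) reads "n₁ … n_k yield m".
module RuleSystem (R : Set) (finite-R : Finite R) (arity : R → ℕ)
  (aut : (r : R) → DFA (Vec (Maybe ⊤) (suc (arity r)))) where

  Fires : (r : R) → Vec ℕ (suc (arity r)) → Set
  Fires r ns = accepts (aut r) (conv (Vec.map unary ns)) ≡ true

  data Derivable : ℕ → Set where
    derive : (r : R) (ns : Vec ℕ (suc (arity r))) → Fires r ns →
             (∀ c → isPremise c ≡ true → Derivable (lookup ns c)) →
             Derivable (lookup ns (fromℕ (arity r)))

  Violation : (ℕ → Bool) → ℕ → Set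
  Violation β n = Σ R λ r → Σ (Vec ℕ (suc (arity r))) λ ns →
    (∀ c → lookup ns c < n) × Fires r ns × (∀ c → β (lookup ns c) ≡ isPremise c)

  weaken : ∀ β n → Violation β n → Violation β (suc n)
  weaken β n (r , ns , lt , fires , roles) = r , ns , (λ c → m≤n⇒m≤1+n (lt c)) , fires , roles

  -- It reads β and guesses rule instances on the fly;
  -- a configuration (r , q , A) records the rule, the state of its automaton
  -- on the columns read so far, and which tracks are still running.
  Config : Set
  Config = Σ R λ r → Fin (DFA.nStates (aut r)) × Vec Bool (suc (arity r))

  finite-Config : Finite Config
  finite-Config = finite-Σ finite-R (λ r → finite-× (finite-Fin _) (finite-Vec finite-Bool _))

  nConfig : ℕ
  nConfig = size finite-Config

  encodeC : Config → Fin nConfig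
  encodeC = encode finite-Config

  decodeC : Fin nConfig → Config
  decodeC = decode finite-Config

  -- Running tracks may stop (never restart); a track stopping at time n ends
  -- at n, so β n must be its role (premise ↦ true, conclusion ↦ false).
  validUpdate : {k : ℕ} → Vec Bool (suc k) → Bool → Vec Bool (suc k) → Bool
  validUpdate {k} A b A′ = allFin (suc k) λ c →
    (lookup A′ c ⇒ᵇ lookup A c) ∧ ((lookup A c ∧ not (lookup A′ c)) ⇒ᵇ (b ≡ᴮ isPremise c))

  -- Closing the instance now: every running track ends at the current time.
  allEndNow : {k : ℕ} → Vec Bool (suc k) → Bool → Bool
  allEndNow {k} A b = allFin (suc k) λ c → lookup A c ⇒ᵇ (b ≡ᴮ isPremise c)

  someRunning : {k : ℕ} → Vec Bool (suc k) → Bool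
  someRunning {k} A = anyFin (suc k) (lookup A)

  columnOf : {k : ℕ} → Vec Bool k → Vec (Maybe ⊤) k
  columnOf = Vec.map bit

  successor? : Config → Bool → Fin nConfig → Bool
  successor? (r , q , A) b p′ = anyVec (suc (arity r)) λ A′ →
    validUpdate A b A′ ∧ (someRunning A′ ∧ (encodeC (r , DFA.δ (aut r) q (columnOf A′) , A′) ≡ᶠ p′))

  completes? : Config → Bool → Bool
  completes? (r , q , A) b = DFA.final (aut r) q ∧ allEndNow A b

  initial? : Config → Bool
  initial? (r , q , A) = (q ≡ᶠ DFA.start (aut r)) ∧ allFin (suc (arity r)) (lookup A)

  -- Detector states: a (sticky) violation flag and a set of configurations.
  DetState : Set
  DetState = Bool × Vec Bool nConfig

  detStep : DetState → Bool → DetState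
  detStep (flag , cs) b =
    (flag ∨ anyFin nConfig (λ p → lookup cs p ∧ completes? (decodeC p) b)) ,
    tabulate (λ p′ → anyFin nConfig (λ p → lookup cs p ∧ successor? (decodeC p) b p′))

  detStart : DetState
  detStart = false , tabulate (initial? ∘ decodeC)

  detRun : (ℕ → Bool) → ℕ → DetState
  detRun β zero    = detStart
  detRun β (suc n) = detStep (detRun β n) (β n)

  stateAfter : (r : R) → Vec ℕ (suc (arity r)) → ℕ → Fin (DFA.nStates (aut r))
  stateAfter r ns n = runFrom (aut r) (DFA.start (aut r)) (column ns) n

  -- Invariant: configuration (r , q , A) is present after n steps iff some
  -- tuple ns realises it: track c is running iff n ≤ ns c, some track is
  -- running, q is the automaton state after n columns, and every track that
  -- has already ended carries its role in β.
  Realised : (ℕ → Bool) → ℕ → Config → Set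
  Realised β n (r , q , A) = Σ (Vec ℕ (suc (arity r))) λ ns →
    (∀ c → lookup A c ≡ (n ≤ᵇ lookup ns c)) × (someRunning A ≡ true) × (q ≡ stateAfter r ns n) ×
    (∀ c → (n ≤ᵇ lookup ns c) ≡ false → β (lookup ns c) ≡ isPremise c)

  column-cong : ∀ {k} (ns ns′ : Vec ℕ k) j → (∀ c → track (lookup ns′ c) j ≡ track (lookup ns c) j) →
                column ns′ j ≡ column ns j
  column-cong ns ns′ j h = lookup-ext _ _ (λ c → trans (lookup-map c _ ns′) (trans (h c) (sym (lookup-map c _ ns))))

  column≡columnOf : ∀ {k} (ns : Vec ℕ k) (A : Vec Bool k) n →
                    (∀ c → lookup A c ≡ (suc n ≤ᵇ lookup ns c)) → column ns n ≡ columnOf A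
  column≡columnOf ns A n h = lookup-ext _ _ (λ c →
    trans (lookup-map c _ ns) (trans (cong bit (sym (h c))) (sym (lookup-map c bit A))))

  stateAfter-cong : ∀ r n (ns ns′ : Vec ℕ (suc (arity r))) →
    (∀ c j → j < n → track (lookup ns′ c) j ≡ track (lookup ns c) j) → stateAfter r ns′ n ≡ stateAfter r ns n
  stateAfter-cong r n ns ns′ h =
    runFrom-cong (aut r) n _ (column ns′) (column ns) (λ j j<n → column-cong ns ns′ j (λ c → h c j j<n))

  configAt : (r : R) → Vec ℕ (suc (arity r)) → ℕ → Config
  configAt r ns n = r , stateAfter r ns n , tabulate (λ c → n ≤ᵇ lookup ns c)

  -- A witness for the next step, track by track: a track that keeps running
  -- gets length n+1, one that stops now gets length n, an ended one is kept.
  advance : ℕ → Bool → Bool → ℕ → ℕ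
  advance n true  true  m = suc n
  advance n true  false m = n
  advance n false _     m = m

  advance-spec : ∀ n (β : ℕ → Bool) a a′ m role → a ≡ (n ≤ᵇ m) →
    ((a′ ⇒ᵇ a) ∧ ((a ∧ not a′) ⇒ᵇ (β n ≡ᴮ role))) ≡ true → ((n ≤ᵇ m) ≡ false → β m ≡ role) →
    (a′ ≡ (suc n ≤ᵇ advance n a a′ m)) × (∀ j → j < n → track (advance n a a′ m) j ≡ track m j) ×
    ((suc n ≤ᵇ advance n a a′ m) ≡ false → β (advance n a a′ m) ≡ role)
  advance-spec n β true true m role a≡ valid ended =
    sym (≤⇒≤ᵇ-true {suc n} ≤-refl) ,
    (λ j j<n → trans (track-< (suc n) j (m≤n⇒m≤1+n j<n)) (sym (track-< m j (<-≤-trans j<n (≤ᵇ-true⇒ n m (sym a≡)))))) ,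
    (λ e → ⊥-elim (true≢false (trans (sym (≤⇒≤ᵇ-true {suc n} ≤-refl)) e)))
  advance-spec n β true false m role a≡ valid ended =
    sym (>⇒≤ᵇ-false {suc n} {n} ≤-refl) ,
    (λ j j<n → trans (track-< n j j<n) (sym (track-< m j (<-≤-trans j<n (≤ᵇ-true⇒ n m (sym a≡)))))) ,
    (λ _ → does-true⇒ (β n Bool.≟ role) valid)
  advance-spec n β false false m role a≡ valid ended =
    sym (≤ᵇ-suc-false n m (sym a≡)) , (λ j _ → refl) , (λ _ → ended (sym a≡))

  realised-step : ∀ n β c p → Realised β n c → successor? c (β n) p ≡ true → Realised β (suc n) (decodeC p)
  realised-step n β (r , q , A) p (ns , hA , running , hq , ended) h with anyVec-witness (suc (arity r)) _ h
  ... | A′ , h′ = subst (Realised β (suc n)) (trans (sym (decode-encode finite-Config c′)) (cong decodeC c′≡p))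
                        (ns′ , hA′ , running′ , hq′ , ended′)
    where
    valid = ∧-conicalˡ _ _ h′
    rest = ∧-conicalʳ (validUpdate A (β n) A′) _ h′
    running′ = ∧-conicalˡ _ _ rest
    c′ : Config
    c′ = r , DFA.δ (aut r) q (columnOf A′) , A′
    c′≡p : encodeC c′ ≡ p
    c′≡p = does-true⇒ (encodeC c′ Fin.≟ p) (∧-conicalʳ (someRunning A′) _ rest)
    f : Fin (suc (arity r)) → ℕ
    f c = advance n (lookup A c) (lookup A′ c) (lookup ns c)
    ns′ = tabulate f
    spec = λ c → advance-spec n β (lookup A c) (lookup A′ c) (lookup ns c) (isPremise c) (hA c) (allFin-elim _ _ valid c) (ended c)
    hA′ : ∀ c → lookup A′ c ≡ (suc n ≤ᵇ lookup ns′ c)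
    hA′ c = trans (proj₁ (spec c)) (cong (suc n ≤ᵇ_) (sym (lookup∘tabulate f c)))
    ended′ : ∀ c → (suc n ≤ᵇ lookup ns′ c) ≡ false → β (lookup ns′ c) ≡ isPremise c
    ended′ c rewrite lookup∘tabulate f c = proj₂ (proj₂ (spec c))
    hq′ : DFA.δ (aut r) q (columnOf A′) ≡ stateAfter r ns′ (suc n)
    hq′ = sym (trans (runFrom-snoc (aut r) n _ (column ns′))
      (cong₂ (DFA.δ (aut r))
        (trans (stateAfter-cong r n ns ns′ (λ c j j<n → trans (cong (λ x → track x j) (lookup∘tabulate f c)) (proj₁ (proj₂ (spec c)) j j<n))) (sym hq))
        (column≡columnOf ns′ A′ n hA′)))

  realised-sound : ∀ β n p → lookup (proj₂ (detRun β n)) p ≡ true → Realised β n (decodeC p)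
  realised-sound β zero p h = initial (decodeC p) (trans (sym (lookup∘tabulate _ p)) h)
    where
    initial : ∀ c → initial? c ≡ true → Realised β zero c
    initial (r , q , A) h′ = Vec.replicate _ 0 , allFin-elim _ _ allRunning ,
      anyFin-intro _ _ zero (allFin-elim _ _ allRunning zero) , does-true⇒ (q Fin.≟ _) (∧-conicalˡ _ _ h′) , (λ c ())
      where allRunning = ∧-conicalʳ (q ≡ᶠ DFA.start (aut r)) _ h′
  realised-sound β (suc n) p h with anyFin-witness nConfig _ (trans (sym (lookup∘tabulate _ p)) h)
  ... | p₀ , h′ = realised-step n β (decodeC p₀) p (realised-sound β n p₀ (∧-conicalˡ _ _ h′))
                    (∧-conicalʳ (lookup (proj₂ (detRun β n)) p₀) _ h′)

  update-valid : ∀ n (β : ℕ → Bool) m role → ((suc n ≤ᵇ m) ≡ false → β m ≡ role) →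
    (((suc n ≤ᵇ m) ⇒ᵇ (n ≤ᵇ m)) ∧ (((n ≤ᵇ m) ∧ not (suc n ≤ᵇ m)) ⇒ᵇ (β n ≡ᴮ role))) ≡ true
  update-valid n β m role ended with suc n ≤ᵇ m in e₁ | n ≤ᵇ m in e₂
  ... | true  | true  = refl
  ... | true  | false = ⊥-elim (true≢false (trans (sym (≤ᵇ-suc-true n m e₁)) e₂))
  ... | false | false = refl
  ... | false | true  = dec-true (β n Bool.≟ role) (trans (cong β (sym (≤ᵇ-exact n m e₂ e₁))) (ended refl))

  realised-complete : ∀ β n c → Realised β n c → lookup (proj₂ (detRun β n)) (encodeC c) ≡ true
  realised-complete β zero (r , q , A) (ns , hA , running , hq , ended) =
    trans (lookup∘tabulate _ (encodeC (r , q , A)))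
      (subst (λ x → initial? x ≡ true) (sym (decode-encode finite-Config (r , q , A)))
        (∧-intro (dec-true (q Fin.≟ _) hq) (allFin-intro _ _ hA)))
  realised-complete β (suc n) (r , q′ , A′) (ns , hA′ , running′ , hq′ , ended′) =
    trans (lookup∘tabulate _ (encodeC (r , q′ , A′)))
      (anyFin-intro nConfig _ (encodeC c₀) (∧-intro (realised-complete β n c₀ realised₀) step))
    where
    A = tabulate (λ c → n ≤ᵇ lookup ns c)
    c₀ = configAt r ns n
    hA : ∀ c → lookup A c ≡ (n ≤ᵇ lookup ns c)
    hA = lookup∘tabulate (λ c → n ≤ᵇ lookup ns c)
    running : someRunning A ≡ true
    running with anyFin-witness _ _ running′
    ... | c , h = anyFin-intro _ _ c (trans (hA c) (≤ᵇ-suc-true n _ (trans (sym (hA′ c)) h)))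
    realised₀ : Realised β n c₀
    realised₀ = ns , hA , running , refl , (λ c e → ended′ c (≤ᵇ-suc-false n _ e))
    valid : validUpdate A (β n) A′ ≡ true
    valid = allFin-intro _ _ (λ c →
      subst₂ (λ x y → ((y ⇒ᵇ x) ∧ ((x ∧ not y) ⇒ᵇ (β n ≡ᴮ isPremise c))) ≡ true)
        (sym (hA c)) (sym (hA′ c)) (update-valid n β (lookup ns c) (isPremise c) (ended′ c)))
    next : DFA.δ (aut r) (stateAfter r ns n) (columnOf A′) ≡ q′
    next = sym (trans hq′ (trans (runFrom-snoc (aut r) n _ (column ns))
             (cong (DFA.δ (aut r) (stateAfter r ns n)) (column≡columnOf ns A′ n hA′))))
    step₀ : successor? c₀ (β n) (encodeC (r , q′ , A′)) ≡ true
    step₀ = anyVec-intro _ _ A′ (∧-intro valid (∧-intro running′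
      (dec-true (_ Fin.≟ _) (cong (λ x → encodeC (r , x , A′)) next))))
    step : successor? (decodeC (encodeC c₀)) (β n) (encodeC (r , q′ , A′)) ≡ true
    step = subst (λ x → successor? x (β n) (encodeC (r , q′ , A′)) ≡ true) (sym (decode-encode finite-Config c₀)) step₀

  close : ℕ → Bool → ℕ → ℕ
  close n true  m = n
  close n false m = m

  close-spec : ∀ n (β : ℕ → Bool) a m role → a ≡ (n ≤ᵇ m) → (a ⇒ᵇ (β n ≡ᴮ role)) ≡ true →
    ((n ≤ᵇ m) ≡ false → β m ≡ role) →
    (close n a m < suc n) × (∀ j → j < n → track (close n a m) j ≡ track m j) × (β (close n a m) ≡ role)
  close-spec n β true m role a≡ valid ended = ≤-refl ,
    (λ j j<n → trans (track-< n j j<n) (sym (track-< m j (<-≤-trans j<n (≤ᵇ-true⇒ n m (sym a≡)))))) ,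
    does-true⇒ (β n Bool.≟ role) valid
  close-spec n β false m role a≡ valid ended = m≤n⇒m≤1+n (≤ᵇ-false⇒ n m (sym a≡)) , (λ j _ → refl) , ended (sym a≡)

  completes⇒violation : ∀ n β c → Realised β n c → completes? c (β n) ≡ true → Violation β (suc n)
  completes⇒violation n β (r , q , A) (ns , hA , running , hq , ended) h = r , ns′ , lt , fires , roles
    where
    endNow = ∧-conicalʳ (DFA.final (aut r) q) _ h
    f : Fin (suc (arity r)) → ℕ
    f c = close n (lookup A c) (lookup ns c)
    ns′ = tabulate f
    spec = λ c → close-spec n β (lookup A c) (lookup ns c) (isPremise c) (hA c) (allFin-elim _ _ endNow c) (ended c)
    lt : ∀ c → lookup ns′ c < suc n
    lt c rewrite lookup∘tabulate f c = proj₁ (spec c)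
    roles : ∀ c → β (lookup ns′ c) ≡ isPremise c
    roles c rewrite lookup∘tabulate f c = proj₂ (proj₂ (spec c))
    max≡n : maxᵛ ns′ ≡ n
    max≡n with anyFin-witness _ _ running
    ... | c , hc = maxᵛ-attained ns′ n (λ c → ≤-pred (lt c)) c
                     (trans (lookup∘tabulate f c) (cong (λ x → close n x (lookup ns c)) hc))
    fires : Fires r ns′
    fires = begin
        accepts (aut r) (conv (Vec.map unary ns′))
      ≡⟨ accepts-unary (aut r) ns′ ⟩
        DFA.final (aut r) (stateAfter r ns′ (maxᵛ ns′))
      ≡⟨ cong (λ k → DFA.final (aut r) (stateAfter r ns′ k)) max≡n ⟩
        DFA.final (aut r) (stateAfter r ns′ n)
      ≡⟨ cong (DFA.final (aut r)) (stateAfter-cong r n ns ns′ (λ c j j<n →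
           trans (cong (λ x → track x j) (lookup∘tabulate f c)) (proj₁ (proj₂ (spec c)) j j<n))) ⟩
        DFA.final (aut r) (stateAfter r ns n)
      ≡⟨ cong (DFA.final (aut r)) (sym hq) ⟩
        DFA.final (aut r) q
      ≡⟨ ∧-conicalˡ _ _ h ⟩
        true
      ∎
      where open ≡-Reasoning

  flag⇒violation : ∀ β n → proj₁ (detRun β n) ≡ true → Violation β n
  flag⇒violation β (suc n) h with ∨-true {proj₁ (detRun β n)} h
  ... | inj₁ p = weaken β n (flag⇒violation β n p)
  ... | inj₂ p with anyFin-witness nConfig _ p
  ...   | p₀ , h′ = completes⇒violation n β (decodeC p₀) (realised-sound β n p₀ (∧-conicalˡ _ _ h′))
                      (∧-conicalʳ (lookup (proj₂ (detRun β n)) p₀) _ h′)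

  violation⇒flag : ∀ β n → Violation β n → proj₁ (detRun β n) ≡ true
  violation⇒flag β zero (r , ns , lt , _) = ⊥-elim (n≮0 (lt zero))
  violation⇒flag β (suc n) (r , ns , lt , fires , roles) with anyFin (suc (arity r)) (λ c → lookup ns c ≡ᵇ n) in e
  ... | false = ∨-introˡ _ (violation⇒flag β n (r , ns , lt′ , fires , roles))
    where
    lt′ : ∀ c → lookup ns c < n
    lt′ c = ≤∧≢⇒< (≤-pred (lt c)) (λ eq → true≢false (trans (sym (dec-true (lookup ns c ≟ n) eq)) (anyFin-false _ _ e c)))
  ... | true = ∨-introʳ (proj₁ (detRun β n)) (anyFin-intro nConfig _ (encodeC c₀) (∧-intro (realised-complete β n c₀ realised₀) completes))
    where
    -- some entry equals n: the instance can be closed at time n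
    witness = anyFin-witness _ _ e
    c* = proj₁ witness
    c*≡n : lookup ns c* ≡ n
    c*≡n = does-true⇒ (lookup ns c* ≟ n) (proj₂ witness)
    A = tabulate (λ c → n ≤ᵇ lookup ns c)
    c₀ = configAt r ns n
    hA : ∀ c → lookup A c ≡ (n ≤ᵇ lookup ns c)
    hA = lookup∘tabulate (λ c → n ≤ᵇ lookup ns c)
    realised₀ : Realised β n c₀
    realised₀ = ns , hA , anyFin-intro _ _ c* (trans (hA c*) (≤⇒≤ᵇ-true (≤-reflexive (sym c*≡n)))) , refl , (λ c _ → roles c)
    accepting : DFA.final (aut r) (stateAfter r ns n) ≡ true
    accepting = trans (cong (λ k → DFA.final (aut r) (stateAfter r ns k)) (sym (maxᵛ-attained ns n (λ c → ≤-pred (lt c)) c* c*≡n)))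
                      (trans (sym (accepts-unary (aut r) ns)) fires)
    endsNow : ∀ c → ((n ≤ᵇ lookup ns c) ⇒ᵇ (β n ≡ᴮ isPremise c)) ≡ true
    endsNow c with n ≤ᵇ lookup ns c in e′
    ... | false = refl
    ... | true  = dec-true (β n Bool.≟ isPremise c)
                    (trans (cong β (≤-antisym (≤ᵇ-true⇒ n _ e′) (≤-pred (lt c)))) (roles c))
    completes : completes? (decodeC (encodeC c₀)) (β n) ≡ true
    completes = subst (λ x → completes? x (β n) ≡ true) (sym (decode-encode finite-Config c₀))
      (∧-intro accepting (allFin-intro _ _ (λ c → subst (λ x → (x ⇒ᵇ (β n ≡ᴮ isPremise c)) ≡ true) (sym (hA c)) (endsNow c))))

  -- The detector as an automaton over Bool; its final states are the unflagged
  -- ones.  The state encoding is kept opaque: only decode-encode is needed.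
  opaque
    finite-DetState : Finite DetState
    finite-DetState = finite-× finite-Bool (finite-Vec finite-Bool nConfig)

  detector : DFA Bool
  detector = record
    { nStates = size finite-DetState
    ; start   = encode finite-DetState detStart
    ; δ       = λ p b → encode finite-DetState (detStep (decode finite-DetState p) b)
    ; final   = λ p → not (proj₁ (decode finite-DetState p))
    }

  detector-run : ∀ β n → decode finite-DetState (runFrom detector (DFA.start detector) β n) ≡ detRun β n
  detector-run β zero    = decode-encode finite-DetState detStart
  detector-run β (suc n) = trans (cong (decode finite-DetState) (runFrom-snoc detector n (DFA.start detector) β))
    (trans (decode-encode finite-DetState _) (cong (λ s → detStep s (β n)) (detector-run β n)))

  detector-sticky : ∀ p b → DFA.final detector p ≡ false → DFA.final detector (DFA.δ detector p b) ≡ false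
  detector-sticky p b h = trans (cong (not ∘ proj₁) (decode-encode finite-DetState _))
                                (cong not (∨-introˡ _ (Bool.not-injective h)))

  q₀ : Fin (DFA.nStates detector)
  q₀ = DFA.start detector

  rejection⇒violation : ∀ β n → DFA.final detector (runFrom detector q₀ β n) ≡ false → Violation β n
  rejection⇒violation β n h = flag⇒violation β n
    (Bool.not-injective (trans (cong (not ∘ proj₁) (sym (detector-run β n))) h))

  violation⇒rejection : ∀ β n → Violation β n → DFA.final detector (runFrom detector q₀ β n) ≡ false
  violation⇒rejection β n v = trans (cong (not ∘ proj₁) (detector-run β n)) (cong not (violation⇒flag β n v))

  open Greedy detector detector-sticky

  N : ℕ
  N = DFA.nStates detector

  -- The all-true sequence violates nothing (a conclusion would have to be
  -- false), so rejection is avoidable from the start.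
  allTrue-closed : ∀ n → ¬ Violation (λ _ → true) n
  allTrue-closed n (r , ns , _ , _ , roles) = true≢false (trans (roles (fromℕ (arity r))) (isPremise-fromℕ (arity r)))

  start-safe : safe N q₀ ≡ true
  start-safe = safe-intro N q₀ allTrue unrejected
    where
    allTrue : ℕ → Bool
    allTrue _ = true
    unrejected : DFA.final detector (runFrom detector q₀ allTrue N) ≡ true
    unrejected = Bool.¬-not {y = false} (λ e → allTrue-closed N (rejection⇒violation allTrue N e))

  χ-closed : ∀ k → ¬ Violation χ k
  χ-closed k v = true≢false (trans (sym (χ-unrejected start-safe k)) (violation⇒rejection χ k v))

  derivable⇒χ : ∀ m → Derivable m → χ m ≡ true
  derivable⇒χ _ (derive r ns fires premises) = Bool.¬-not {y = false} λ χo →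
    χ-closed (suc (maxᵛ ns)) (r , ns , (λ c → s≤s (lookup≤maxᵛ ns c)) , fires ,
      roles-of ns χ (λ c p → derivable⇒χ _ (premises c p)) χo)
  -- Let v mark
  -- positions n+1+j (j < N) known to be derivable.  The splice of χ at n with v
  -- is rejected (χ-forced), so some rule instance below n+1+N has its premises
  -- in the splice and its conclusion o outside.  The premises are derivable
  -- (below n by induction, above n by v), hence so is o; o < n contradicts
  -- derivable⇒χ, o = n is the goal, and o > n is a new derivable position in
  -- the window: add it to v and retry.  v gains a true each round, so the
  -- number of its falses in the window bounds the number of rounds.
  χ⇒derivable-step : ∀ n → (∀ m → m < n → χ m ≡ true → Derivable m) → χ n ≡ true → Derivable n
  χ⇒derivable-step n IH χn = search N (λ _ → false) (≤-reflexive (falses-allFalse N)) (λ j _ ())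
    where
    inWindow : ∀ x → n < x → x < suc n + N → (x ≡ suc n + (x ∸ suc n)) × (x ∸ suc n < N)
    inWindow x n<x x<end = sym (m+[n∸m]≡n n<x) ,
      +-cancelˡ-< (suc n) (x ∸ suc n) N (subst (_< suc n + N) (sym (m+[n∸m]≡n n<x)) x<end)

    search : (fuel : ℕ) (v : ℕ → Bool) → falses N v ≤ fuel →
             (∀ j → j < N → v j ≡ true → Derivable (suc n + j)) → Derivable n
    search fuel v bound known = conclude (rejection⇒violation (splice χ n v) (suc n + N)
      (χ-forced n χn (splice χ n v) (splice-< χ n v) (splice-≡ χ n v)))
      where
      premise : ∀ x → x < suc n + N → splice χ n v x ≡ true → Derivable x
      premise x x<end px = Data.Sum.[
        (λ (x<n , χx) → IH x x<n χx) ,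
        (λ (n<x , vx) → let (x≡ , j<N) = inWindow x n<x x<end in
                        subst Derivable (sym x≡) (known (x ∸ suc n) j<N vx)) ] (splice-true χ n v x px)

      retry : ∀ j → j < N → v j ≡ false → Derivable (suc n + j) → Derivable n
      retry j j<N vj d = next fuel bound
        where
        known′ : ∀ j′ → j′ < N → setTrue v j j′ ≡ true → Derivable (suc n + j′)
        known′ j′ j′<N h = Data.Sum.[ known j′ j′<N ,
          (λ j′≡j → subst (λ y → Derivable (suc n + y)) (sym (does-true⇒ (j′ ≟ j) j′≡j)) d) ] (∨-true {v j′} h)
        next : (fuel : ℕ) → falses N v ≤ fuel → Derivable n
        next zero        bound′ = ⊥-elim (<⇒≱ (<-≤-trans z<s (falses-setTrue N v j j<N vj)) bound′)
        next (suc fuel′) bound′ = search fuel′ (setTrue v j) (≤-pred (≤-trans (falses-setTrue N v j j<N vj) bound′)) known′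

      derived : ∀ o → Derivable o → splice χ n v o ≡ false → o < suc n + N → Derivable n
      derived o d po o<end = Data.Sum.[
        (λ (o<n , χo) → ⊥-elim (true≢false (trans (sym (derivable⇒χ o d)) χo))) , Data.Sum.[
        (λ o≡n → subst Derivable o≡n d) ,
        (λ (n<o , vo) → let (o≡ , j<N) = inWindow o n<o o<end in
                        retry (o ∸ suc n) j<N vo (subst Derivable o≡ d)) ] ] (splice-false χ n v o po)

      conclude : Violation (splice χ n v) (suc n + N) → Derivable n
      conclude (r , ns , lt , fires , roles) =
        derived (lookup ns (fromℕ (arity r)))
          (derive r ns fires (λ c isP → premise (lookup ns c) (lt c) (trans (roles c) isP)))
          (trans (roles (fromℕ (arity r))) (isPremise-fromℕ (arity r))) (lt (fromℕ (arity r)))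

  χ⇒derivable : ∀ n → χ n ≡ true → Derivable n
  χ⇒derivable = <-rec (λ n → χ n ≡ true → Derivable n) (λ n IH → χ⇒derivable-step n (λ m m<n → IH m<n))

  recogniser : DFA ⊤
  recogniser = record { nStates = N ; start = q₀ ; δ = λ q _ → greedyStep q ; final = choice }

  recogniser-accepts : ∀ w → accepts recogniser w ≡ χ (length w)
  recogniser-accepts w = cong choice (from 0 w)
    where
    from : ∀ n (w : List ⊤) → foldl (λ q _ → greedyStep q) (greedyState n) w ≡ greedyState (n + length w)
    from n []      = cong greedyState (sym (+-identityʳ n))
    from n (_ ∷ w) = trans (from (suc n) w) (cong greedyState (sym (+-suc n (length w))))

  derivable-regular : Recognizes recogniser (λ w → Derivable (length w))
  derivable-regular w = mk⇔ (λ acc → χ⇒derivable _ (trans (sym (recogniser-accepts w)) acc))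
                            (λ der → trans (recogniser-accepts w) (derivable⇒χ _ der))

bump : {n : ℕ} → Fin (suc n) → Fin (suc n)
bump {zero}  zero    = zero
bump {suc n} zero    = suc zero
bump {suc n} (suc i) = suc (bump i)

toℕ-bump : ∀ {n} (s : Fin (suc n)) → toℕ (bump s) ≡ suc (toℕ s) ⊓ n
toℕ-bump {zero}  zero    = refl
toℕ-bump {suc n} zero    = refl
toℕ-bump {suc n} (suc i) = cong suc (toℕ-bump i)

counter : ℕ → DFA (Vec (Maybe ⊤) 1)
counter L = record { nStates = suc (suc L) ; start = zero ; δ = λ s _ → bump s ; final = λ s → toℕ s ≡ᵇ L }

counter-run : ∀ L f k → toℕ (runFrom (counter L) zero f k) ≡ k ⊓ suc L
counter-run L f zero    = refl
counter-run L f (suc k) = begin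
    toℕ (runFrom (counter L) zero f (suc k))         ≡⟨ cong toℕ (runFrom-snoc (counter L) k zero f) ⟩
    toℕ (bump (runFrom (counter L) zero f k))        ≡⟨ toℕ-bump _ ⟩
    suc (toℕ (runFrom (counter L) zero f k)) ⊓ suc L ≡⟨ cong (λ x → suc x ⊓ suc L) (counter-run L f k) ⟩
    (suc k ⊓ suc (suc L)) ⊓ suc L                     ≡⟨ ⊓-assoc (suc k) (suc (suc L)) (suc L) ⟩
    suc k ⊓ (suc (suc L) ⊓ suc L)                     ≡⟨ cong (suc k ⊓_) (m≥n⇒m⊓n≡n (n≤1+n (suc L))) ⟩
    suc k ⊓ suc L                                     ∎
  where open ≡-Reasoning

counter-accepts : ∀ L m → (accepts (counter L) (conv (Vec.map unary (m ∷ []))) ≡ true) ⇔ (m ≡ L)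
counter-accepts L m = mk⇔ to from
  where
  accepts≡ : accepts (counter L) (conv (Vec.map unary (m ∷ []))) ≡ (m ⊓ suc L ≡ᵇ L)
  accepts≡ = trans (accepts-unary (counter L) (m ∷ []))
    (cong (_≡ᵇ L) (trans (counter-run L _ (m ⊔ 0)) (cong (_⊓ suc L) (⊔-identityʳ m))))
  to : accepts (counter L) (conv (Vec.map unary (m ∷ []))) ≡ true → m ≡ L
  to h with ⊓-sel m (suc L)
  ... | inj₁ m⊓≡m  = trans (sym m⊓≡m) capped
    where capped = does-true⇒ (m ⊓ suc L ≟ L) (trans (sym accepts≡) h)
  ... | inj₂ m⊓≡sL = ⊥-elim (1+n≢n (trans (sym m⊓≡sL) (does-true⇒ (m ⊓ suc L ≟ L) (trans (sym accepts≡) h))))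
  from : m ≡ L → accepts (counter L) (conv (Vec.map unary (m ∷ []))) ≡ true
  from refl = trans accepts≡ (dec-true (m ⊓ suc m ≟ m) (m≤n⇒m⊓n≡m (n≤1+n m)))

module Subalgebra (𝒮 : Algebra) (P : InjUnaryFAPres 𝒮) (gens : List (Word ⊤)) where
  open Algebra 𝒮
  open InjUnaryFAPres P

  -- One rule for the graph of each operation, and one 0-ary rule for each
  -- generator g, given by the singleton relation {|g|}.
  Rule : Set
  Rule = Fin nOps ⊎ Fin (length gens)

  ruleArity : Rule → ℕ
  ruleArity (inj₁ i) = arity i
  ruleArity (inj₂ g) = 0

  ruleAut : (r : Rule) → DFA (Vec (Maybe ⊤) (suc (ruleArity r)))
  ruleAut (inj₁ i) = proj₁ (graphAut i)
  ruleAut (inj₂ g) = counter (length (List.lookup gens g))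

  open RuleSystem Rule (finite-⊎ (finite-Fin nOps) (finite-Fin (length gens))) ruleArity ruleAut public

  X : List Carrier
  X = map φ gens

  -- The graph automaton fires on exactly the exponent tuples of graph tuples,
  -- since a tuple of unary words is determined by its convolution.
  fires-graph : ∀ i (ns : Vec ℕ (suc (arity i))) → Fires (inj₁ i) ns ⇔ Graph i (Vec.map φ (Vec.map unary ns))
  fires-graph i ns = mk⇔ to (λ g → Equivalence.from (proj₂ (graphAut i) _) (Vec.map unary ns , refl , g))
    where
    to : Fires (inj₁ i) ns → Graph i (Vec.map φ (Vec.map unary ns))
    to fires with Equivalence.to (proj₂ (graphAut i) _) fires
    ... | ws , conv≡ , graph = subst (Graph i ∘ Vec.map φ) (sym ws≡) graph
      where
      ws≡ : Vec.map unary ns ≡ ws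
      ws≡ = trans (cong (Vec.map unary) (conv-unary-injective ns (Vec.map length ws)
                    (trans conv≡ (cong conv (sym (unary-lengths ws))))))
                  (unary-lengths ws)

  fires-generator : ∀ g m → Fires (inj₂ g) (m ∷ []) ⇔ (m ≡ length (List.lookup gens g))
  fires-generator g m = counter-accepts (length (List.lookup gens g)) m

  element : ∀ {k} (ns : Vec ℕ k) c → lookup (Vec.map φ (Vec.map unary ns)) c ≡ φ (unary (lookup ns c))
  element ns c = trans (lookup-map c φ (Vec.map unary ns)) (cong φ (lookup-map c unary ns))

  derivable⇒member : ∀ m → Derivable m → InSubalg 𝒮 X (φ (unary m))
  derivable⇒member _ (derive (inj₁ i) ns fires premises) = subst (InSubalg 𝒮 X) result (apply i (init V) args)
    where
    V = Vec.map φ (Vec.map unary ns)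
    result : op i (init V) ≡ φ (unary (lookup ns (fromℕ (arity i))))
    result = trans (Equivalence.to (fires-graph i ns) fires) (trans (lookup-last V) (element ns _))
    args : ∀ j → InSubalg 𝒮 X (lookup (init V) j)
    args j = subst (InSubalg 𝒮 X) (sym (trans (lookup-init V j) (element ns (inject₁ j))))
                   (derivable⇒member _ (premises (inject₁ j) (isPremise-inject₁ j)))
  derivable⇒member _ (derive (inj₂ g) (m ∷ []) fires _) = subst (InSubalg 𝒮 X) (cong φ g≡) (gen (∈-map⁺ φ (∈-lookup g)))
    where
    g≡ : List.lookup gens g ≡ unary m
    g≡ = trans (sym (unary-length _)) (cong unary (sym (Equivalence.to (fires-generator g m) fires)))

  member⇒derivable : ∀ x → InSubalg 𝒮 X x → ∀ n → φ (unary n) ≡ x → Derivable n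
  member⇒derivable x (gen x∈X) n φn≡x with ∈-map⁻ φ x∈X
  ... | w , w∈gens , x≡φw = derive (inj₂ (index w∈gens)) (n ∷ []) (Equivalence.from (fires-generator _ n) n≡) (λ { zero () })
    where
    n≡ : n ≡ length (List.lookup gens (index w∈gens))
    n≡ = trans (sym (List.length-replicate n))
               (cong length (trans (φ-inj (trans φn≡x x≡φw)) (lookup-index w∈gens)))
  member⇒derivable _ (apply i xs members) n φn≡ =
    subst Derivable (lookup-∷ʳ-fromℕ (tabulate pre) n) (derive (inj₁ i) ns fires premises)
    where
    -- the length of a word representing argument j (φ is surjective)
    pre : Fin (arity i) → ℕ
    pre j = length (proj₁ (φ-surj (lookup xs j)))
    pre-rep : ∀ j → φ (unary (pre j)) ≡ lookup xs j
    pre-rep j = trans (cong φ (unary-length _)) (proj₂ (φ-surj (lookup xs j)) refl)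
    ns : Vec ℕ (suc (arity i))
    ns = tabulate pre ∷ʳ n
    at-premise : ∀ j → lookup ns (inject₁ j) ≡ pre j
    at-premise j = trans (lookup-∷ʳ-inject₁ (tabulate pre) n j) (lookup∘tabulate pre j)
    premises : ∀ c → isPremise c ≡ true → Derivable (lookup ns c)
    premises c isP with premise-inject₁ c isP
    ... | j , refl = subst Derivable (sym (at-premise j)) (member⇒derivable _ (members j) (pre j) (pre-rep j))
    V = Vec.map φ (Vec.map unary ns)
    inputs : init V ≡ xs
    inputs = lookup-ext _ _ (λ j → trans (lookup-init V j)
      (trans (element ns (inject₁ j)) (trans (cong (φ ∘ unary) (at-premise j)) (pre-rep j))))
    output : last V ≡ op i xs
    output = trans (lookup-last V)
      (trans (element ns _) (trans (cong (φ ∘ unary) (lookup-∷ʳ-fromℕ (tabulate pre) n)) φn≡))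
    fires : Fires (inj₁ i) ns
    fires = Equivalence.from (fires-graph i ns) (trans (cong (op i) inputs) (sym output))

  derivable⇔member : ∀ w → Derivable (length w) ⇔ InSubalg 𝒮 X (φ w)
  derivable⇔member w = mk⇔
    (λ d → subst (InSubalg 𝒮 X ∘ φ) (unary-length w) (derivable⇒member _ d))
    (λ m → member⇒derivable _ m (length w) (cong φ (unary-length w)))

theorem5p1 : (𝒮 : Algebra) (P : InjUnaryFAPres 𝒮) (gens : List (Word ⊤)) →
    Σ (DFA ⊤) λ M →
    Recognizes M (λ w → InSubalg 𝒮 (map (InjUnaryFAPres.φ P) gens) (InjUnaryFAPres.φ P w))
theorem5p1 𝒮 P gens = recogniser , λ w → ⇔.trans (derivable-regular w) (derivable⇔member w)
  where open Subalgebra 𝒮 P gens
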